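{- Let $k$ be a positive integer, $a=6k+5$, $b=a+\frac{a-3}{2}=9k+6$, $c=b+1=9k+7$ and $S=\{a,b,c\}$. Then the numerical semigroup $\langle S\rangle$ is a $3$-permutation numerical semigroup.
   Context: A numerical semigroup is a submonoid $G$ of $(\mathbb{N},+,0)$ with $\mathbb{N}\setminus G$ finite; $\langle S\rangle$ is the submonoid generated by $S$. Write the elements of $G$ as $0=g_0<g_1<g_2<\cdots$. For $n\ge 1$, $G$ is an $n$-permutation numerical semigroup if $G=\langle g_1,\dots,g_n\rangle$ and for every integer $k\ge 0$ the tuple $(g_{kn+1}\bmod n,\dots,g_{kn+n}\bmod n)$ contains exactly one representative of each residue class of $\mathbb{Z}/n\mathbb{Z}$. -}

module Defs where

open import Data.Nat using (ℕ; zero; suc; _+_; _*_; _<_; _≤_; NonZero)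
open import Data.Nat.DivMod using (_%_)
open import Data.Fin using (Fin; toℕ)
open import Data.List using (List)
open import Data.List.Membership.Propositional using (_∈_)
open import Data.Product using (Σ; ∃; _×_; _,_)
open import Relation.Binary.PropositionalEquality using (_≡_)

Subset : Set₁
Subset = ℕ → Set

data ⟨_⟩ (S : List ℕ) : ℕ → Set where
  gen-zero : ⟨ S ⟩ 0
  gen-elem : ∀ {s} → s ∈ S → ⟨ S ⟩ s
  gen-add  : ∀ {x y} → ⟨ S ⟩ x → ⟨ S ⟩ y → ⟨ S ⟩ (x + y)

IsSubmonoid : Subset → Set
IsSubmonoid G = G 0 × (∀ {x y} → G x → G y → G (x + y))

IsNumericalSemigroup : Subset → Set
IsNumericalSemigroup G = IsSubmonoid G × Σ ℕ (λ N → ∀ x → N ≤ x → G x)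

Enumerates : Subset → (ℕ → ℕ) → Set
Enumerates G g =
  (∀ i → g i < g (suc i)) ×
  (∀ i → G (g i)) ×
  (∀ x → G x → ∃ λ i → g i ≡ x)

firstGens : (ℕ → ℕ) → (n : ℕ) → List ℕ
firstGens g n = go n
  where
  open import Data.List using ([]; _∷_; _++_)
  go : ℕ → List ℕ
  go zero = []
  go (suc m) = go m ++ (g (suc m) ∷ [])

_≐_ : Subset → Subset → Set
G ≐ H = ∀ x → (G x → H x) × (H x → G x)

IsPermutationNS : (n : ℕ) → .{{NonZero n}} → Subset → Set
IsPermutationNS n G =
  IsNumericalSemigroup G ×
  Σ (ℕ → ℕ) λ g →
    Enumerates G g ×
    (G ≐ ⟨ firstGens g n ⟩) ×
    (∀ k → (r : Fin n) →
       (∃ λ (j : Fin n) → g (k * n + suc (toℕ j)) % n ≡ toℕ r) ×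
       (∀ (j j′ : Fin n) →
          g (k * n + suc (toℕ j)) % n ≡ toℕ r →
          g (k * n + suc (toℕ j′)) % n ≡ toℕ r → j ≡ j′))

-- With u = 3k + 2 the generators are a = 2u + 1, b = 3u and c = 3u + 1, so αa + βb + γc = u·P + q
-- with P = 2α + 3β + 3γ and q = α + γ. For fixed P ≥ 2 these q fill the interval from lowest (P mod 3)
-- to ⌊P/2⌋ (the level P). Levels 2, …, 6k + 3 are disjoint and increasing, and from u(6k + 4) + 2 on the
-- semigroup contains every integer. An even level has ≡ 1 and an odd level ≡ 2 (mod 3) elements, so
-- the last element of every odd level has an index divisible by 3. Inside a level consecutive
-- elements differ by 1, and the jump after an even level is ≡ 1 (mod 3); hence g (3t + 1), g (3t + 2),
-- g (3t + 3) are congruent to x, x + 1, x + 2, which is a permutation of the residues modulo 3.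

module Submission where

open import Defs
open import Data.Nat using (ℕ; zero; suc; pred; _+_; _*_; _∸_; _≤_; _<_; z≤n; s≤s; NonZero)
open import Data.Nat.Properties
  using (+-comm; +-assoc; +-suc; +-identityʳ; *-zeroʳ; *-assoc; *-distribʳ-+; ≤-refl; ≤-trans;
         ≤-reflexive; ≤-pred; n≤1+n; m≤m+n; m≤n+m; +-mono-≤; +-cancelˡ-≤; +-cancelˡ-<; *-cancelʳ-<;
         ≤-<-connex; <-cmp; <⇒≤; ∸-monoˡ-≤; m+n∸n≡m; m∸n+n≡m; m≤n⇒∃[o]m+o≡n)
open import Data.Nat.DivMod
  using (_%_; _/_; %-distribˡ-+; [m+kn]%n≡m%n; m<n⇒m%n≡m; m%n<n; m%n%n≡m%n; %-remove-+ʳ; m≡m%n+[m/n]*n)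
open import Data.Nat.Divisibility using (_∣_; divides)
open import Data.Nat.Tactic.RingSolver using (solve; solve-∀)
open import Data.Fin using (Fin; toℕ; fromℕ<; zero; suc)
open import Data.Fin.Properties using (toℕ-injective; toℕ<n; toℕ-fromℕ<)
open import Data.List using (List; []; _∷_)
open import Data.List.Relation.Unary.Any using (here; there)
open import Data.Product using (∃; ∃₂; _×_; _,_)
open import Data.Sum using (inj₁; inj₂)
open import Data.Unit using (⊤; tt)
open import Data.Empty using (⊥-elim)
open import Function.Base using (_∋_; _∘_)
open import Relation.Binary using (tri<; tri≈; tri>)
open import Relation.Binary.PropositionalEquality
open ≡-Reasoning

+-%-congˡ : ∀ m {n p} d .{{_ : NonZero d}} → n % d ≡ p % d → (m + n) % d ≡ (m + p) % d
+-%-congˡ m {n} {p} d eq = begin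
  (m + n) % d          ≡⟨ %-distribˡ-+ m n d ⟩
  (m % d + n % d) % d  ≡⟨ cong (λ r → (m % d + r) % d) eq ⟩
  (m % d + p % d) % d  ≡⟨ %-distribˡ-+ m p d ⟨
  (m + p) % d          ∎

module _ (n x : ℕ) where

  private
    rotate : ∀ i → n * x + (i + x) ≡ i + x * suc n
    rotate i = solve (n ∷ x ∷ i ∷ [])

    reassociate : ∀ i → x + (i + n * x) ≡ n * x + (i + x)
    reassociate i = solve (n ∷ x ∷ i ∷ [])

    unshift : ∀ i → i < suc n → (n * x + (i + x)) % suc n ≡ i
    unshift i i<1+n = begin
      (n * x + (i + x)) % suc n  ≡⟨ cong (_% suc n) (rotate i) ⟩
      (i + x * suc n) % suc n    ≡⟨ [m+kn]%n≡m%n i x (suc n) ⟩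
      i % suc n                  ≡⟨ m<n⇒m%n≡m i<1+n ⟩
      i                          ∎

  +-%-injective : ∀ (j j′ : Fin (suc n)) → (toℕ j + x) % suc n ≡ (toℕ j′ + x) % suc n → j ≡ j′
  +-%-injective j j′ eq = toℕ-injective (begin
    toℕ j                           ≡⟨ unshift (toℕ j) (toℕ<n j) ⟨
    (n * x + (toℕ j + x)) % suc n   ≡⟨ +-%-congˡ (n * x) (suc n) eq ⟩
    (n * x + (toℕ j′ + x)) % suc n  ≡⟨ unshift (toℕ j′) (toℕ<n j′) ⟩
    toℕ j′                          ∎)

  +-%-surjective : ∀ (r : Fin (suc n)) → ∃ λ (j : Fin (suc n)) → (toℕ j + x) % suc n ≡ toℕ r
  +-%-surjective r = j , (begin
    (toℕ j + x) % suc n            ≡⟨ cong (λ i → (i + x) % suc n) (toℕ-fromℕ< (m%n<n y (suc n))) ⟩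
    (y % suc n + x) % suc n        ≡⟨ cong (_% suc n) (+-comm (y % suc n) x) ⟩
    (x + y % suc n) % suc n        ≡⟨ +-%-congˡ x (suc n) (m%n%n≡m%n y (suc n)) ⟩
    (x + y) % suc n                ≡⟨ cong (_% suc n) (reassociate (toℕ r)) ⟩
    (n * x + (toℕ r + x)) % suc n  ≡⟨ unshift (toℕ r) (toℕ<n r) ⟩
    toℕ r                          ∎)
    where
    y = toℕ r + n * x
    j = fromℕ< (m%n<n y (suc n))

  shifted-residues-bijective :
    (f : Fin (suc n) → ℕ) → (∀ j → f j % suc n ≡ (toℕ j + x) % suc n) →
    ∀ r → (∃ λ j → f j % suc n ≡ toℕ r) ×
          (∀ j j′ → f j % suc n ≡ toℕ r → f j′ % suc n ≡ toℕ r → j ≡ j′)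
  shifted-residues-bijective f f≡ r with j , j+x≡r ← +-%-surjective r =
    (j , trans (f≡ j) j+x≡r) ,
    λ j j′ fj≡r fj′≡r →
      +-%-injective j j′ (trans (sym (f≡ j)) (trans fj≡r (trans (sym fj′≡r) (f≡ j′))))

point-+ : ∀ u P q P′ q′ → u * P + q + (u * P′ + q′) ≡ u * (P + P′) + (q + q′)
point-+ = solve-∀

jump : ∀ u {P P′} x y z → P′ ≡ suc P → u + x ≡ suc (y + z) → u * P′ + x ≡ suc (u * P + y + z)
jump u {P} x y z refl u+x≡ = begin
  u * suc P + x          ≡⟨ solve (u ∷ P ∷ x ∷ []) ⟩
  u * P + (u + x)        ≡⟨ cong (u * P +_) u+x≡ ⟩
  u * P + suc (y + z)    ≡⟨ +-suc (u * P) (y + z) ⟩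
  suc (u * P + (y + z))  ≡⟨ cong suc (+-assoc (u * P) y z) ⟨
  suc (u * P + y + z)    ∎

split-≤-+ : ∀ c w {j} → j ≤ c + w → ∃₂ λ i j′ → i ≤ c × j′ ≤ w × j ≡ i + j′
split-≤-+ c w {j} j≤c+w with ≤-<-connex j w
... | inj₁ j≤w = 0 , j , z≤n , j≤w , refl
... | inj₂ w<j =
  j ∸ w , w , ≤-trans (∸-monoˡ-≤ w j≤c+w) (≤-reflexive (m+n∸n≡m c w)) , ≤-refl ,
  sym (m∸n+n≡m (<⇒≤ w<j))

data ℤ₃ : Set where
  0₃ 1₃ 2₃ : ℤ₃

suc₃ : ℤ₃ → ℤ₃
suc₃ 0₃ = 1₃
suc₃ 1₃ = 2₃
suc₃ 2₃ = 0₃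

suc₃³ : ∀ x → suc₃ (suc₃ (suc₃ x)) ≡ x
suc₃³ 0₃ = refl
suc₃³ 1₃ = refl
suc₃³ 2₃ = refl

_+₃_ : ℤ₃ → ℤ₃ → ℤ₃
0₃ +₃ y = y
1₃ +₃ y = suc₃ y
2₃ +₃ y = suc₃ (suc₃ y)

suc₃-+₃ : ∀ x y → suc₃ x +₃ y ≡ suc₃ (x +₃ y)
suc₃-+₃ 0₃ y = refl
suc₃-+₃ 1₃ y = refl
suc₃-+₃ 2₃ y = sym (suc₃³ y)

[_]₃ : ℕ → ℤ₃
[ zero ]₃  = 0₃
[ suc n ]₃ = suc₃ [ n ]₃

[m+n]₃ : ∀ m n → [ m + n ]₃ ≡ [ m ]₃ +₃ [ n ]₃
[m+n]₃ zero    n = refl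
[m+n]₃ (suc m) n = trans (cong suc₃ ([m+n]₃ m n)) (sym (suc₃-+₃ [ m ]₃ [ n ]₃))

[m*3]₃≡0₃ : ∀ m → [ m * 3 ]₃ ≡ 0₃
[m*3]₃≡0₃ zero    = refl
[m*3]₃≡0₃ (suc m) = trans (suc₃³ [ m * 3 ]₃) ([m*3]₃≡0₃ m)

[m*3+n]₃≡[n]₃ : ∀ m n → [ m * 3 + n ]₃ ≡ [ n ]₃
[m*3+n]₃≡[n]₃ m n = trans ([m+n]₃ (m * 3) n) (cong (_+₃ [ n ]₃) ([m*3]₃≡0₃ m))

[m*6+n]₃≡[n]₃ : ∀ m n → [ m * 6 + n ]₃ ≡ [ n ]₃
[m*6+n]₃≡[n]₃ m n = trans (cong (λ p → [ p + n ]₃) (sym (*-assoc m 2 3))) ([m*3+n]₃≡[n]₃ (m * 2) n)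

-- lowest [ P ]₃ is the least q with u·P + q in level P.
lowest : ℤ₃ → ℕ
lowest 0₃ = 0
lowest 1₃ = 2
lowest 2₃ = 1

lowest-subadditive : ∀ x y → lowest (x +₃ y) ≤ lowest x + lowest y
lowest-subadditive 0₃ y  = ≤-refl
lowest-subadditive 1₃ 0₃ = ≤-refl
lowest-subadditive 1₃ 1₃ = s≤s z≤n
lowest-subadditive 1₃ 2₃ = z≤n
lowest-subadditive 2₃ 0₃ = ≤-refl
lowest-subadditive 2₃ 1₃ = z≤n
lowest-subadditive 2₃ 2₃ = ≤-refl

Admissible : ℕ → ℕ → Set
Admissible P q = lowest [ P ]₃ ≤ q × q * 2 ≤ P

admissible-+ : ∀ {P q P′ q′} → Admissible P q → Admissible P′ q′ → Admissible (P + P′) (q + q′)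
admissible-+ {P} {q} {P′} {q′} (l≤q , q≤P) (l′≤q′ , q′≤P′) =
  ≤-trans (≤-reflexive (cong lowest ([m+n]₃ P P′)))
    (≤-trans (lowest-subadditive [ P ]₃ [ P′ ]₃) (+-mono-≤ l≤q l′≤q′)) ,
  ≤-trans (≤-reflexive (*-distribʳ-+ 2 q q′)) (+-mono-≤ q≤P q′≤P′)

-- Levels P ≥ 2 are written P = lvl m o = 6m + ⌜ o ⌝.
data Offset : Set where
  o₂ o₃ o₄ o₅ o₆ o₇ : Offset

⌜_⌝ : Offset → ℕ
⌜ o₂ ⌝ = 2
⌜ o₃ ⌝ = 3
⌜ o₄ ⌝ = 4
⌜ o₅ ⌝ = 5
⌜ o₆ ⌝ = 6
⌜ o₇ ⌝ = 7

lvl : ℕ → Offset → ℕ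
lvl m o = m * 6 + ⌜ o ⌝

least : Offset → ℕ
least o = lowest [ ⌜ o ⌝ ]₃

-- Level lvl m o consists of u·P + q for least o ≤ q ≤ ⌊P/2⌋, i.e. q = least o + j with j ≤ width o m.
width : Offset → ℕ → ℕ
width o₂ m = m * 3
width o₃ m = 1 + m * 3
width o₄ m = m * 3
width o₅ m = 1 + m * 3
width o₆ m = 3 + m * 3
width o₇ m = 1 + m * 3

width-suc : ∀ o m → width o (suc m) ≡ 3 + width o m
width-suc o₂ m = refl
width-suc o₃ m = refl
width-suc o₄ m = refl
width-suc o₅ m = refl
width-suc o₆ m = refl
width-suc o₇ m = refl

lowest-lvl : ∀ m o → lowest [ lvl m o ]₃ ≡ least o
lowest-lvl m o = cong lowest ([m*6+n]₃≡[n]₃ m ⌜ o ⌝)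

lvl≤ : ∀ m o → lvl m o ≤ suc ((least o + width o m) * 2)
lvl≤ m o₂ = ≤-trans (≤-reflexive (m * 6 + 2 ≡ (1 + m * 3) * 2 ∋ solve (m ∷ []))) (n≤1+n _)
lvl≤ m o₃ = ≤-reflexive (m * 6 + 3 ≡ suc ((0 + (1 + m * 3)) * 2) ∋ solve (m ∷ []))
lvl≤ m o₄ = ≤-trans (≤-reflexive (m * 6 + 4 ≡ (2 + m * 3) * 2 ∋ solve (m ∷ []))) (n≤1+n _)
lvl≤ m o₅ = ≤-reflexive (m * 6 + 5 ≡ suc ((1 + (1 + m * 3)) * 2) ∋ solve (m ∷ []))
lvl≤ m o₆ = ≤-trans (≤-reflexive (m * 6 + 6 ≡ (0 + (3 + m * 3)) * 2 ∋ solve (m ∷ []))) (n≤1+n _)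
lvl≤ m o₇ = ≤-reflexive (m * 6 + 7 ≡ suc ((2 + (1 + m * 3)) * 2) ∋ solve (m ∷ []))

width-bound : ∀ m o j → (least o + j) * 2 ≤ lvl m o → j ≤ width o m
width-bound m o j le =
  +-cancelˡ-≤ (least o) j (width o m)
    (≤-pred (*-cancelʳ-< 2 (least o + j) (suc (least o + width o m)) (s≤s (≤-trans le (lvl≤ m o)))))

lvl-wrap : ∀ m → suc m * 6 + 2 ≡ suc (m * 6 + 7)
lvl-wrap = solve-∀

split-lvl : ∀ P → ∃₂ λ m o → 2 + P ≡ lvl m o
split-lvl zero = 0 , o₂ , refl
split-lvl (suc P) with split-lvl P
... | m , o₂ , eq = m , o₃ , trans (cong suc eq) (sym (+-suc (m * 6) 2))
... | m , o₃ , eq = m , o₄ , trans (cong suc eq) (sym (+-suc (m * 6) 3))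
... | m , o₄ , eq = m , o₅ , trans (cong suc eq) (sym (+-suc (m * 6) 4))
... | m , o₅ , eq = m , o₆ , trans (cong suc eq) (sym (+-suc (m * 6) 5))
... | m , o₆ , eq = m , o₇ , trans (cong suc eq) (sym (+-suc (m * 6) 6))
... | m , o₇ , eq = suc m , o₂ , trans (cong suc eq) (sym (lvl-wrap m))

-- level m M o j r: the element least o + j of level 6m + ⌜ o ⌝, followed by r more in that level;
-- M counts the blocks of six levels that remain before the tail.
data State : Set where
  level : (m M : ℕ) (o : Offset) (j r : ℕ) → State
  tail  : (y : ℕ) → State

start : ℕ → ℕ → Offset → State
start m M o = level m M o 0 (width o m)

next : State → State
next (level m M o j (suc r))     = level m M o (suc j) r
next (level m M o₂ j zero)       = start m M o₃
next (level m zero o₃ j zero)    = tail 0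
next (level m (suc M) o₃ j zero) = start m (suc M) o₄
next (level m M o₄ j zero)       = start m M o₅
next (level m M o₅ j zero)       = start m M o₆
next (level m M o₆ j zero)       = start m M o₇
next (level m M o₇ j zero)       = start (suc m) (pred M) o₂
next (tail y)                    = tail (suc y)

-- One less than the difference to the next element.
gap : State → ℕ
gap (level m M o j (suc r)) = 0
gap (level m M o₂ j zero)   = M * 3
gap (level m M o₃ j zero)   = M * 3 + 2
gap (level m M o₄ j zero)   = M * 3
gap (level m M o₅ j zero)   = pred M * 3 + 2
gap (level m M o₆ j zero)   = M * 3
gap (level m M o₇ j zero)   = pred M * 3 + 2
gap (tail y)                = 0

-- The index modulo 3 in the enumeration: even levels start at an index ≡ 1, odd ones at ≡ 2.
first : Offset → ℕ
first o₂ = 1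
first o₃ = 2
first o₄ = 1
first o₅ = 2
first o₆ = 1
first o₇ = 2

phase : State → ℤ₃
phase (level m M o j r) = [ first o + j ]₃
phase (tail y)          = [ suc y ]₃

-- The last block stops after level 6k + 3; beyond it the semigroup is an interval.
Visited : Offset → ℕ → Set
Visited o₂ M = ⊤
Visited o₃ M = ⊤
Visited _  M = 1 ≤ M

visited-suc : ∀ o M → Visited o (suc M)
visited-suc o₂ M = tt
visited-suc o₃ M = tt
visited-suc o₄ M = s≤s z≤n
visited-suc o₅ M = s≤s z≤n
visited-suc o₆ M = s≤s z≤n
visited-suc o₇ M = s≤s z≤n

module Construction (k : ℕ) where

  u : ℕ
  u = 3 * k + 2

  S : List ℕ
  S = 6 * k + 5 ∷ 9 * k + 6 ∷ 9 * k + 7 ∷ []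

  a-point : 6 * k + 5 ≡ (3 * k + 2) * 2 + 1
  a-point = solve (k ∷ [])

  b-point : 9 * k + 6 ≡ (3 * k + 2) * 3 + 0
  b-point = solve (k ∷ [])

  c-point : 9 * k + 7 ≡ (3 * k + 2) * 3 + 1
  c-point = solve (k ∷ [])

  origin : 0 ≡ u * 0 + 0
  origin = sym (trans (+-identityʳ (u * 0)) (*-zeroʳ u))

  a∈ : ⟨ S ⟩ (u * 2 + 1)
  a∈ = subst ⟨ S ⟩ a-point (gen-elem (here refl))

  b∈ : ⟨ S ⟩ (u * 3 + 0)
  b∈ = subst ⟨ S ⟩ b-point (gen-elem (there (here refl)))

  c∈ : ⟨ S ⟩ (u * 3 + 1)
  c∈ = subst ⟨ S ⟩ c-point (gen-elem (there (there (here refl))))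

  _⊕_ : ∀ {P q P′ q′} → ⟨ S ⟩ (u * P + q) → ⟨ S ⟩ (u * P′ + q′) →
        ⟨ S ⟩ (u * (P + P′) + (q + q′))
  _⊕_ {P} {q} {P′} {q′} x y = subst ⟨ S ⟩ (point-+ u P q P′ q′) (gen-add x y)

  u*6+i∈ : ∀ i → i ≤ 3 → ⟨ S ⟩ (u * 6 + i)
  u*6+i∈ 0 _ = b∈ ⊕ b∈
  u*6+i∈ 1 _ = b∈ ⊕ c∈
  u*6+i∈ 2 _ = c∈ ⊕ c∈
  u*6+i∈ 3 _ = a∈ ⊕ (a∈ ⊕ a∈)
  u*6+i∈ (suc (suc (suc (suc i)))) (s≤s (s≤s (s≤s ())))

  level-mem : ∀ m o j → j ≤ width o m → ⟨ S ⟩ (u * lvl m o + (least o + j))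
  level-mem zero o₂ zero _                = a∈
  level-mem zero o₃ zero _                = b∈
  level-mem zero o₃ (suc zero) _          = c∈
  level-mem zero o₃ (suc (suc j)) (s≤s ())
  level-mem zero o₄ zero _                = a∈ ⊕ a∈
  level-mem zero o₅ zero _                = a∈ ⊕ b∈
  level-mem zero o₅ (suc zero) _          = a∈ ⊕ c∈
  level-mem zero o₅ (suc (suc j)) (s≤s ())
  level-mem zero o₆ j j≤3                 = u*6+i∈ j j≤3
  level-mem zero o₇ zero _                = a∈ ⊕ (a∈ ⊕ b∈)
  level-mem zero o₇ (suc zero) _          = a∈ ⊕ (a∈ ⊕ c∈)
  level-mem zero o₇ (suc (suc j)) (s≤s ())
  level-mem (suc m) o j j≤w′
    with i , j′ , i≤3 , j′≤w , refl ← split-≤-+ 3 (width o m) (subst (j ≤_) (width-suc o m) j≤w′) =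
    subst (λ q → ⟨ S ⟩ (u * lvl (suc m) o + q)) (swap (least o) i j′)
      (u*6+i∈ i i≤3 ⊕ level-mem m o j′ j′≤w)
    where
    swap : ∀ l i j′ → i + (l + j′) ≡ l + (i + j′)
    swap l i j′ = solve (l ∷ i ∷ j′ ∷ [])

  tail-point : ℕ → ℕ
  tail-point y = u * lvl k o₄ + (2 + y)

  last-o₅≡tail-point :
    ∀ j → (3 * k + 2) * (k * 6 + 5) + (1 + j) ≡ (3 * k + 2) * (k * 6 + 4) + (2 + (suc (k * 3) + j))
  last-o₅≡tail-point j = solve (k ∷ j ∷ [])

  last-o₆≡tail-point :
    ∀ j → (3 * k + 2) * (k * 6 + 6) + (0 + j) ≡ (3 * k + 2) * (k * 6 + 4) + (2 + (2 + k * 6 + j))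
  last-o₆≡tail-point j = solve (k ∷ j ∷ [])

  last-o₇≡tail-point :
    ∀ j → (3 * k + 2) * (k * 6 + 7) + (2 + j) ≡ (3 * k + 2) * (k * 6 + 4) + (2 + (6 + k * 9 + j))
  last-o₇≡tail-point j = solve (k ∷ j ∷ [])

  -- Levels 6k + 4, 6k + 5 and 6k + 6 of the last block cover tail-point y for y < 9k + 6.
  tail-segment : ∀ y → y < 9 * k + 6 → ⟨ S ⟩ (tail-point y)
  tail-segment y y<b with ≤-<-connex y (k * 3)
  ... | inj₁ y≤3k = level-mem k o₄ y y≤3k
  ... | inj₂ 3k<y with y₁ , refl ← m≤n⇒∃[o]m+o≡n 3k<y with ≤-<-connex y₁ (1 + k * 3)
  ...   | inj₁ y₁≤ = subst ⟨ S ⟩ (last-o₅≡tail-point y₁) (level-mem k o₅ y₁ y₁≤)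
  ...   | inj₂ lt with y₂ , refl ← m≤n⇒∃[o]m+o≡n lt =
    subst ⟨ S ⟩ (trans (last-o₆≡tail-point (suc y₂)) (cong tail-point (regroup y₂)))
      (level-mem k o₆ (suc y₂) y₂<3+3k)
    where
    regroup : ∀ y₂ → 2 + k * 6 + suc y₂ ≡ suc (k * 3) + (suc (1 + k * 3) + y₂)
    regroup y₂ = solve (k ∷ y₂ ∷ [])
    b≡ : 9 * k + 6 ≡ suc (k * 3) + (suc (1 + k * 3) + (3 + k * 3))
    b≡ = solve (k ∷ [])
    y₂<3+3k : y₂ < 3 + k * 3
    y₂<3+3k = +-cancelˡ-< (suc (1 + k * 3)) y₂ (3 + k * 3)
                (+-cancelˡ-< (suc (k * 3)) _ _ (subst (suc (k * 3) + (suc (1 + k * 3) + y₂) <_) b≡ y<b))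

  tail-mem : ∀ y → ⟨ S ⟩ (tail-point y)
  tail-mem y =
    subst (λ z → ⟨ S ⟩ (tail-point z)) (sym (m≡m%n+[m/n]*n y b)) (periodic (y / b) (m%n<n y b))
    where
    b = suc (9 * k + 5)
    b≡ : suc (9 * k + 5) ≡ 9 * k + 6
    b≡ = solve (k ∷ [])
    shift : ∀ x r s c → x + (2 + (r + s)) + c ≡ x + (2 + (r + (c + s)))
    shift x r s c = solve (x ∷ r ∷ s ∷ c ∷ [])
    periodic : ∀ t → y % b < b → ⟨ S ⟩ (tail-point (y % b + t * b))
    periodic zero    r<b = subst (λ z → ⟨ S ⟩ (tail-point z)) (sym (+-identityʳ (y % b)))
                             (tail-segment (y % b) (subst (y % b <_) b≡ r<b))
    periodic (suc t) r<b = subst ⟨ S ⟩ (shift (u * lvl k o₄) (y % b) (t * b) b)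
                             (gen-add (periodic t r<b) (subst ⟨ S ⟩ (sym b≡) (gen-elem (there (here refl)))))

  elem : State → ℕ
  elem (level m M o j r) = u * lvl m o + (least o + j)
  elem (tail y)          = tail-point y

  state : ℕ → State
  state zero    = start 0 k o₂
  state (suc n) = next (state n)

  g : ℕ → ℕ
  g zero    = 0
  g (suc n) = elem (state n)

  WellFormed : State → Set
  WellFormed (level m M o j r) = m + M ≡ k × r + j ≡ width o m × Visited o M
  WellFormed (tail y)          = ⊤

  wf-start : ∀ m M o → m + M ≡ k → Visited o M → WellFormed (start m M o)
  wf-start m M o eq v = eq , +-identityʳ (width o m) , v

  wf-next : ∀ s → WellFormed s → WellFormed (next s)
  wf-next (level m M o j (suc r)) (eq , r+j≡w , v) = eq , trans (+-suc r j) r+j≡w , v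
  wf-next (level m M o₂ j zero) (eq , _ , _)        = wf-start m M o₃ eq tt
  wf-next (level m zero o₃ j zero) _                = tt
  wf-next (level m (suc M) o₃ j zero) (eq , _ , _)  = wf-start m (suc M) o₄ eq (s≤s z≤n)
  wf-next (level m M o₄ j zero) (eq , _ , v)        = wf-start m M o₅ eq v
  wf-next (level m M o₅ j zero) (eq , _ , v)        = wf-start m M o₆ eq v
  wf-next (level m M o₆ j zero) (eq , _ , v)        = wf-start m M o₇ eq v
  wf-next (level m (suc M) o₇ j zero) (eq , _ , _)  = wf-start (suc m) M o₂ (trans (sym (+-suc m M)) eq) tt
  wf-next (tail y) _                                = tt

  wf-state : ∀ n → WellFormed (state n)
  wf-state zero    = wf-start 0 k o₂ refl tt
  wf-state (suc n) = wf-next (state n) (wf-state n)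

  -- At the end of level P the next level starts at u·(P + 1) + least, so with k = m + M each case is a
  -- linear identity in m and M.
  next-elem : ∀ s → WellFormed s → elem (next s) ≡ suc (elem s + gap s)
  next-elem (level m M o j (suc r)) _ = step (u * lvl m o) (least o) j
    where
    step : ∀ x l j → x + (l + suc j) ≡ suc (x + (l + j) + 0)
    step x l j = solve (x ∷ l ∷ j ∷ [])
  next-elem (level m M o₂ _ zero) (refl , refl , _) =
    jump u _ (1 + m * 3) (M * 3) (+-suc (m * 6) 2)
      (3 * (m + M) + 2 + 0 ≡ suc (1 + m * 3 + M * 3) ∋ solve (m ∷ M ∷ []))
  next-elem (level m zero o₃ _ zero) (refl , refl , _) =
    jump u _ (0 + (1 + m * 3)) (0 * 3 + 2)
      (trans (cong (λ n → n * 6 + 4) (+-identityʳ m)) (+-suc (m * 6) 3))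
      (3 * (m + 0) + 2 + (2 + 0) ≡ suc (0 + (1 + m * 3) + (0 * 3 + 2)) ∋ solve (m ∷ []))
  next-elem (level m (suc M) o₃ _ zero) (refl , refl , _) =
    jump u _ (0 + (1 + m * 3)) (suc M * 3 + 2) (+-suc (m * 6) 3)
      (3 * (m + suc M) + 2 + 2 ≡ suc (0 + (1 + m * 3) + (suc M * 3 + 2)) ∋ solve (m ∷ M ∷ []))
  next-elem (level m M o₄ _ zero) (refl , refl , _) =
    jump u _ (2 + m * 3) (M * 3) (+-suc (m * 6) 4)
      (3 * (m + M) + 2 + 1 ≡ suc (2 + m * 3 + M * 3) ∋ solve (m ∷ M ∷ []))
  next-elem (level m (suc M) o₅ _ zero) (refl , refl , _) =
    jump u _ (1 + (1 + m * 3)) (M * 3 + 2) (+-suc (m * 6) 5)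
      (3 * (m + suc M) + 2 + 0 ≡ suc (1 + (1 + m * 3) + (M * 3 + 2)) ∋ solve (m ∷ M ∷ []))
  next-elem (level m M o₆ _ zero) (refl , refl , _) =
    jump u _ (0 + (3 + m * 3)) (M * 3) (+-suc (m * 6) 6)
      (3 * (m + M) + 2 + 2 ≡ suc (0 + (3 + m * 3) + M * 3) ∋ solve (m ∷ M ∷ []))
  next-elem (level m (suc M) o₇ _ zero) (refl , refl , _) =
    jump u _ (2 + (1 + m * 3)) (M * 3 + 2) (lvl-wrap m)
      (3 * (m + suc M) + 2 + 1 ≡ suc (2 + (1 + m * 3) + (M * 3 + 2)) ∋ solve (m ∷ M ∷ []))
  next-elem (tail y) _ = step (u * lvl k o₄) y
    where
    step : ∀ x y → x + (2 + suc y) ≡ suc (x + (2 + y) + 0)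
    step x y = solve (x ∷ y ∷ [])

  phase-next : ∀ s → WellFormed s → phase (next s) ≡ suc₃ (phase s)
  phase-next (level m M o j (suc r)) _                  = cong [_]₃ (+-suc (first o) j)
  phase-next (level m M o₂ _ zero) (_ , refl , _)       = cong (suc₃ ∘ suc₃) (sym ([m*3]₃≡0₃ m))
  phase-next (level m zero o₃ _ zero) (_ , refl , _)    = cong suc₃ (sym ([m*3]₃≡0₃ (suc m)))
  phase-next (level m (suc M) o₃ _ zero) (_ , refl , _) = cong suc₃ (sym ([m*3]₃≡0₃ (suc m)))
  phase-next (level m M o₄ _ zero) (_ , refl , _)       = cong (suc₃ ∘ suc₃) (sym ([m*3]₃≡0₃ m))
  phase-next (level m M o₅ _ zero) (_ , refl , _)       = cong suc₃ (sym ([m*3]₃≡0₃ (suc m)))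
  phase-next (level m M o₆ _ zero) (_ , refl , _)       = cong (suc₃ ∘ suc₃) (sym ([m*3]₃≡0₃ (suc m)))
  phase-next (level m M o₇ _ zero) (_ , refl , _)       = cong suc₃ (sym ([m*3]₃≡0₃ (suc m)))
  phase-next (tail y) _                                 = refl

  phase-state : ∀ n → phase (state n) ≡ [ suc n ]₃
  phase-state zero    = refl
  phase-state (suc n) = trans (phase-next (state n) (wf-state n)) (cong suc₃ (phase-state n))

  -- Only the last element of an odd level, whose phase is 0₃, is followed by a jump ≢ 1 (mod 3).
  gap-divisible : ∀ s → WellFormed s → phase s ≢ 0₃ → 3 ∣ gap s
  gap-divisible (level m M o j (suc r)) _ _               = divides 0 refl
  gap-divisible (level m M o₂ _ zero) _ _                 = divides M refl
  gap-divisible (level m M o₃ _ zero) (_ , refl , _) ≢0   = ⊥-elim (≢0 ([m*3]₃≡0₃ (suc m)))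
  gap-divisible (level m M o₄ _ zero) _ _                 = divides M refl
  gap-divisible (level m M o₅ _ zero) (_ , refl , _) ≢0   = ⊥-elim (≢0 ([m*3]₃≡0₃ (suc m)))
  gap-divisible (level m M o₆ _ zero) _ _                 = divides M refl
  gap-divisible (level m M o₇ _ zero) (_ , refl , _) ≢0   = ⊥-elim (≢0 ([m*3]₃≡0₃ (suc m)))
  gap-divisible (tail y) _ _                              = divides 0 refl

  g-step : ∀ i → [ i ]₃ ≢ 0₃ → g (suc i) % 3 ≡ suc (g i) % 3
  g-step zero    ≢0 = ⊥-elim (≢0 refl)
  g-step (suc n) ≢0 = begin
    elem (next s) % 3         ≡⟨ cong (_% 3) (next-elem s (wf-state n)) ⟩
    suc (elem s + gap s) % 3  ≡⟨ %-remove-+ʳ (suc (elem s)) (gap-divisible s (wf-state n) phase≢0) ⟩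
    suc (elem s) % 3          ∎
    where
    s = state n
    phase≢0 : phase s ≢ 0₃
    phase≢0 = ≢0 ∘ trans (sym (phase-state n))

  g-step-in-block : ∀ t c → [ c ]₃ ≢ 0₃ → g (t * 3 + suc c) % 3 ≡ suc (g (t * 3 + c)) % 3
  g-step-in-block t c ≢0 =
    trans (cong (λ i → g i % 3) (+-suc (t * 3) c))
      (g-step (t * 3 + c) (≢0 ∘ trans (sym ([m*3+n]₃≡[n]₃ t c))))

  g-block : ∀ t (j : Fin 3) → g (t * 3 + suc (toℕ j)) % 3 ≡ (toℕ j + g (t * 3 + 1)) % 3
  g-block t zero             = refl
  g-block t (suc zero)       = g-step-in-block t 1 (λ ())
  g-block t (suc (suc zero)) =
    trans (g-step-in-block t 2 (λ ()))
      (+-%-congˡ 1 {g (t * 3 + 2)} {suc (g (t * 3 + 1))} 3 (g-step-in-block t 1 (λ ())))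

  elem-mem : ∀ s → WellFormed s → ⟨ S ⟩ (elem s)
  elem-mem (level m M o j r) (_ , r+j≡w , _) = level-mem m o j (subst (j ≤_) r+j≡w (m≤n+m j r))
  elem-mem (tail y) _                         = tail-mem y

  g-mem : ∀ i → ⟨ S ⟩ (g i)
  g-mem zero    = gen-zero
  g-mem (suc n) = elem-mem (state n) (wf-state n)

  g-increasing : ∀ i → g i < g (suc i)
  g-increasing zero    = m≤n+m 1 (u * 2)
  g-increasing (suc n) =
    subst (elem s <_) (sym (next-elem s (wf-state n))) (s≤s (m≤m+n (elem s) (gap s)))
    where
    s = state n

  Reachable : State → Set
  Reachable s = ∃ λ n → state n ≡ s

  reach-next : ∀ {s} → Reachable s → Reachable (next s)
  reach-next (n , eq) = suc n , cong next eq

  reach-along : ∀ {m M o j} i {r} → Reachable (level m M o j (i + r)) → Reachable (level m M o (i + j) r)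
  reach-along zero    p = p
  reach-along {m} {M} {o} {j} (suc i) {r} p =
    subst (λ j′ → Reachable (level m M o j′ r)) (+-suc i j) (reach-along i (reach-next p))

  reach-after : ∀ {m M o} → Reachable (start m M o) → Reachable (next (level m M o (width o m) zero))
  reach-after {m} {M} {o} p =
    reach-next (subst (λ j → Reachable (level m M o j 0)) (+-identityʳ (width o m))
                  (reach-along (width o m) (subst (λ r → Reachable (level m M o 0 r)) (sym (+-identityʳ _)) p)))

  reach-block : ∀ m M → m + M ≡ k → Reachable (start m M o₂)
  reach-start : ∀ m M o → m + M ≡ k → Visited o M → Reachable (start m M o)

  reach-block zero    M eq = 0 , cong (λ M → start 0 M o₂) (sym eq)
  reach-block (suc m) M eq = reach-after (reach-start m (suc M) o₇ (trans (+-suc m M) eq) (s≤s z≤n))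

  reach-start m M o₂ eq _       = reach-block m M eq
  reach-start m M o₃ eq _       = reach-after (reach-block m M eq)
  reach-start m (suc M) o₄ eq _ = reach-after (reach-after (reach-block m (suc M) eq))
  reach-start m (suc M) o₅ eq _ = reach-after (reach-after (reach-after (reach-block m (suc M) eq)))
  reach-start m (suc M) o₆ eq _ =
    reach-after (reach-after (reach-after (reach-after (reach-block m (suc M) eq))))
  reach-start m (suc M) o₇ eq _ =
    reach-after (reach-after (reach-after (reach-after (reach-after (reach-block m (suc M) eq)))))

  reach-tail : ∀ y → Reachable (tail y)
  reach-tail zero    = reach-after (reach-start k 0 o₃ (+-identityʳ k) tt)
  reach-tail (suc y) = reach-next (reach-tail y)

  Hit : ℕ → Set
  Hit x = ∃ λ i → g i ≡ x

  hit-reachable : ∀ {s} → Reachable s → Hit (elem s)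
  hit-reachable (n , eq) = suc n , cong elem eq

  visited-hit : ∀ m M o j → m + M ≡ k → Visited o M → j ≤ width o m → Hit (u * lvl m o + (least o + j))
  visited-hit m M o j eq v j≤w with r , j+r≡w ← m≤n⇒∃[o]m+o≡n j≤w =
    subst (λ i → Hit (u * lvl m o + (least o + i))) (+-identityʳ j)
      (hit-reachable (reach-along j (subst (λ w → Reachable (level m M o 0 w)) (sym j+r≡w) from-start)))
    where
    from-start : Reachable (start m M o)
    from-start = reach-start m M o eq v

  last-block-hit : ∀ o j → j ≤ width o k → Hit (u * lvl k o + (least o + j))
  last-block-hit o₂ j j≤w = visited-hit k 0 o₂ j (+-identityʳ k) tt j≤w
  last-block-hit o₃ j j≤w = visited-hit k 0 o₃ j (+-identityʳ k) tt j≤w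
  last-block-hit o₄ j _   = hit-reachable (reach-tail j)
  last-block-hit o₅ j _   = subst Hit (sym (last-o₅≡tail-point j)) (hit-reachable (reach-tail _))
  last-block-hit o₆ j _   = subst Hit (sym (last-o₆≡tail-point j)) (hit-reachable (reach-tail _))
  last-block-hit o₇ j _   = subst Hit (sym (last-o₇≡tail-point j)) (hit-reachable (reach-tail _))

  beyond-last≡tail-point : ∀ m′ E q →
    (3 * k + 2) * ((suc k + m′) * 6 + E) + q ≡
    (3 * k + 2) * (k * 6 + 4) + (2 + ((3 * k + 2) * (m′ * 6 + E) + q + (k * 6 + 2)))
  beyond-last≡tail-point m′ E q = solve (k ∷ m′ ∷ E ∷ q ∷ [])

  level-hit : ∀ m o j → j ≤ width o m → Hit (u * lvl m o + (least o + j))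
  level-hit m o j j≤w with <-cmp m k
  ... | tri< m<k _ _ with M , refl ← m≤n⇒∃[o]m+o≡n m<k =
    visited-hit m (suc M) o j (+-suc m M) (visited-suc o M) j≤w
  ... | tri≈ _ refl _ = last-block-hit o j j≤w
  ... | tri> _ _ k<m with m′ , refl ← m≤n⇒∃[o]m+o≡n k<m =
    subst Hit (sym (beyond-last≡tail-point m′ ⌜ o ⌝ (least o + j))) (hit-reachable (reach-tail _))

  level-point : ∀ m o {q} → Admissible (lvl m o) q → Hit (u * lvl m o + q)
  level-point m o (l≤q , q*2≤P) with j , refl ← m≤n⇒∃[o]m+o≡n (subst (_≤ _) (lowest-lvl m o) l≤q) =
    level-hit m o j (width-bound m o j q*2≤P)

  hit-point : ∀ {P q} → Admissible P q → Hit (u * P + q)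
  hit-point {0} {0} _ = 0 , origin
  hit-point {1} {suc (suc q)} (_ , s≤s ())
  hit-point {suc (suc P)} {q} adm with m , o , eq ← split-lvl P =
    subst (λ P → Hit (u * P + q)) (sym eq) (level-point m o (subst (λ P → Admissible P q) eq adm))

  decompose : ∀ {x} → ⟨ S ⟩ x → ∃₂ λ P q → Admissible P q × x ≡ u * P + q
  decompose gen-zero                                = 0 , 0 , (z≤n , z≤n) , origin
  decompose (gen-elem (here refl))                  = 2 , 1 , (≤-refl , ≤-refl) , a-point
  decompose (gen-elem (there (here refl)))          = 3 , 0 , (z≤n , z≤n) , b-point
  decompose (gen-elem (there (there (here refl))))  = 3 , 1 , (z≤n , s≤s (s≤s z≤n)) , c-point
  decompose (gen-add x∈ y∈)
    with P , q , adm , refl ← decompose x∈ | P′ , q′ , adm′ , refl ← decompose y∈ =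
    P + P′ , q + q′ , admissible-+ adm adm′ , point-+ u P q P′ q′

  g-surjective : ∀ x → ⟨ S ⟩ x → Hit x
  g-surjective x x∈ with P , q , adm , refl ← decompose x∈ = hit-point adm

  first-gens : firstGens g 3 ≡ S
  first-gens = cong₂ _∷_ (sym a-point) (cong₂ _∷_ (sym b-point) (cong₂ _∷_ (sym c-point) refl))

  is-permutation : IsPermutationNS 3 ⟨ S ⟩
  is-permutation =
    ((gen-zero , gen-add) , tail-point 0 , cofinite) ,
    g , (g-increasing , g-mem , g-surjective) ,
    (λ x → subst (λ l → ⟨ l ⟩ x) (sym first-gens) , subst (λ l → ⟨ l ⟩ x) first-gens) ,
    λ t → shifted-residues-bijective 2 (g (t * 3 + 1)) (λ j → g (t * 3 + suc (toℕ j))) (g-block t)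
    where
    cofinite : ∀ x → tail-point 0 ≤ x → ⟨ S ⟩ x
    cofinite x N≤x with y , refl ← m≤n⇒∃[o]m+o≡n N≤x =
      subst ⟨ S ⟩ (sym (+-assoc (u * lvl k o₄) 2 y)) (tail-mem y)

lemma4p13 : (k : ℕ) → 1 ≤ k →
    IsPermutationNS 3 ⟨ (6 * k + 5) ∷ (9 * k + 6) ∷ (9 * k + 7) ∷ [] ⟩
lemma4p13 k _ = Construction.is-permutation k
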